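{- Let $G$ be a static graph. Define the relation $\preceq_{\mathrm{CPD}}$ on the set of complete path decompositions (CPDs) of paths of $G$ by: for $\mathcal{C}_p=(p',\{(q_1,x_1),\dots,(q_l,x_l)\})$ and $\mathcal{C}_t=(t',\{(r_1,y_1),\dots,(r_m,y_m)\})$, $\mathcal{C}_p\preceq_{\mathrm{CPD}}\mathcal{C}_t$ if and only if $p'=t'$, $l=m$, $(q_1,\dots,q_l)=(r_1,\dots,r_l)$, and $x_h\le y_h$ for all $h\in\{1,\dots,l\}$. Then $\preceq_{\mathrm{CPD}}$ is a well partial order.
   Context: Static graph: given $M_{ -1},M_0,M_{+1}\in(\mathbb{Q}\cup\{ -\infty\})^{n\times n}$, $G$ is the weighted directed multigraph with nodes $\{1,\dots,n\}$ and an arc $(i,j,s)$ from $i$ to $j$ with shift $s\in\{ -1,0,+1\}$ and weight $(M_s)_{ji}$ whenever $(M_s)_{ji}\ne-\infty$. A path is an alternating sequence of nodes and arcs $(v_1,e_1,\dots,v_m)$ with $e_i$ from $v_i$ to $v_{i+1}$; a circuit is a path with $v_1=v_m$; it is elementary if all its nodes except the first and last are pairwise distinct. Complete path decomposition (CPD) of a path $p$: given $p=p_1qp_2$ where $q$ is an elementary circuit all of whose inner nodes occur elsewhere in $p$ (in $p_1$ or $p_2$), remove $q$ to get $p_1p_2$; repeat until no such circuit exists in the remaining path. If $x_j\in\mathbb{N}$ occurrences of elementary circuit $q_j$ were removed ($j=1,\dots,l$) and the remaining path is $p'$, then $(p',\{(q_1,x_1),\dots,(q_l,x_l)\})$ is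 a CPD of $p$. A well partial order on a set $X$ is a partial order $\preceq$ such that every infinite sequence $x_1,x_2,\dots$ in $X$ has an infinite subsequence $x_{i_1}\preceq x_{i_2}\preceq\cdots$ with $i_1<i_2<\cdots$. -}

module Defs where

open import Level using (0ℓ)
open import Data.Nat using (ℕ; suc; _≤_; _<_)
open import Data.Fin using (Fin)
open import Data.Rational using (ℚ)
open import Data.Maybe using (Maybe; is-just)
open import Data.Bool using (T)
open import Data.Product using (Σ; Σ-syntax; ∃; _×_; _,_; proj₁; proj₂)
open import Data.List using (List; []; _∷_; _++_; map; concatMap; replicate)
open import Data.List.Membership.Propositional using (_∈_)
open import Data.List.Relation.Unary.All using (All)
open import Data.List.Relation.Unary.Unique.Propositional using (Unique)
open import Data.List.Relation.Binary.Permutation.Propositional using (_↭_)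
open import Data.List.Relation.Binary.Pointwise using (Pointwise)
open import Relation.Binary.PropositionalEquality using (_≡_; _≢_)
open import Relation.Binary.Structures using (IsPartialOrder)
open import Relation.Nullary using (¬_)
open import Data.Unit using (⊤)

data Shift : Set where
  minus1 zero plus1 : Shift

-- ℚ ∪ {-∞}: nothing represents -∞
ℚ-∞ : Set
ℚ-∞ = Maybe ℚ

-- The three matrices M_{-1}, M_0, M_{+1}; (M s) j i is the entry (M_s)_{ji}.
Matrices : ℕ → Set
Matrices n = Shift → Fin n → Fin n → ℚ-∞

module StaticGraph {n : ℕ} (M : Matrices n) where

  -- arc (i , j , s) from i to j with shift s, present iff (M_s)_{ji} ≠ -∞
  record Arc : Set where
    constructor arc
    field
      src   : Fin n
      tgt   : Fin n
      shift : Shift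
      present : T (is-just (M shift tgt src))
  open Arc public

  -- A (raw) path (v₁, e₁, …, vₘ) is recorded as its first node and its list of arcs;
  -- the remaining nodes are the targets of the arcs.
  RawPath : Set
  RawPath = Fin n × List Arc

  Chain : Fin n → List Arc → Set
  Chain v [] = ⊤
  Chain v (e ∷ es) = (src e ≡ v) × Chain (tgt e) es

  IsPath : RawPath → Set
  IsPath (v , es) = Chain v es

  nodes : RawPath → List (Fin n)
  nodes (v , es) = v ∷ map tgt es

  endNode : Fin n → List Arc → Fin n
  endNode v [] = v
  endNode v (e ∷ es) = endNode (tgt e) es

  dropLast : {A : Set} → List A → List A
  dropLast [] = []
  dropLast (x ∷ []) = []
  dropLast (x ∷ y ∷ xs) = x ∷ dropLast (y ∷ xs)

  innerNodes : RawPath → List (Fin n)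
  innerNodes (w , qs) = dropLast (map tgt qs)

  IsElementaryCircuit : RawPath → Set
  IsElementaryCircuit (w , qs) =
    IsPath (w , qs) × (qs ≢ []) × (endNode w qs ≡ w) × Unique (dropLast (nodes (w , qs)))

  data Step : RawPath → RawPath → RawPath → Set where
    remove : ∀ v es₁ w qs es₂ →
             w ≡ endNode v es₁ →
             IsElementaryCircuit (w , qs) →
             All (_∈ (nodes (v , es₁) ++ nodes (w , es₂))) (innerNodes (w , qs)) →
             Step (v , es₁ ++ qs ++ es₂) (w , qs) (v , es₁ ++ es₂)

  data Steps : RawPath → List RawPath → RawPath → Set where
    done : ∀ p → Steps p [] p
    step : ∀ {p q p₁ R p₂} → Step p q p₁ → Steps p₁ R p₂ → Steps p (q ∷ R) p₂

  Irreducible : RawPath → Set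
  Irreducible p = ∀ q p₁ → ¬ Step p q p₁

  CPDData : Set
  CPDData = RawPath × List (RawPath × ℕ)

  expand : List (RawPath × ℕ) → List RawPath
  expand = concatMap (λ qx → replicate (proj₂ qx) (proj₁ qx))

  -- (p' , L) is a CPD of the path p: the q_j are distinct, x_j ≥ 1 is the number of
  -- removed occurrences of q_j, and the removed circuits are exactly these.
  IsCPDOf : RawPath → CPDData → Set
  IsCPDOf p (p' , L) =
    IsPath p × Σ[ R ∈ List RawPath ]
      (Steps p R p' × Irreducible p' × Unique (map proj₁ L)
       × All (λ qx → 1 ≤ proj₂ qx) L × (R ↭ expand L))

  CPD : Set
  CPD = Σ[ c ∈ CPDData ] ∃ λ p → IsCPDOf p c

  -- equality of CPDs (as objects; ignoring the witnessing path)
  _≈CPD_ : CPD → CPD → Set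
  a ≈CPD b = proj₁ a ≡ proj₁ b

  _≼CPD_ : CPD → CPD → Set
  ((p' , L) , _) ≼CPD ((t' , K) , _) =
    (p' ≡ t') × (map proj₁ L ≡ map proj₁ K) × Pointwise _≤_ (map proj₂ L) (map proj₂ K)

record IsWellPartialOrder {A : Set} (_≈_ : A → A → Set) (_≼_ : A → A → Set) : Set where
  field
    isPartialOrder : IsPartialOrder _≈_ _≼_
    ascendingSubsequence : (f : ℕ → A) →
      Σ[ g ∈ (ℕ → ℕ) ] ((∀ i → g i < g (suc i)) × (∀ i → f (g i) ≼ f (g (suc i))))

{-# OPTIONS --safe #-}
-- The order ≼CPD is equality of skeletons — the remaining path p′ and the circuit list
-- (q₁, …, q_l) — together with the pointwise order on the multiplicities (x₁, …, x_l).
-- Skeletons range over a finite set. The q_j are distinct elementary circuits, hence paths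
-- with at most n arcs. The remaining path p′ is irreducible, hence has fewer than (n+1)n arcs:
-- cut a longer path into n+1 blocks of n arcs; n arcs visit n+1 nodes, so each block contains
-- an elementary circuit, and since irreducibility forbids removing it, some node of the block
-- occurs nowhere else in the path; these are n+1 distinct nodes.
-- An infinite sequence of CPDs therefore has a subsequence of constant skeleton (infinite
-- pigeonhole), and by Dickson's lemma a further subsequence along which the multiplicities
-- ascend. Both principles are classical, whence the excluded-middle hypothesis.
module Submission where

open import Defs
open import Data.Nat using (ℕ)
open import Relation.Nullary using (Dec)

open import Level using (0ℓ)
open import Axiom.ExcludedMiddle using (ExcludedMiddle)
open import Data.Nat using (zero; suc; _+_; _*_; _≤_; _<_; _⊔_; z≤n; s≤s; _≤?_)
open import Data.Nat.Properties
  using ( +-suc; +-comm; suc-injective; ≤-refl; ≤-reflexive; ≤-trans; ≤-antisym; <-trans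
        ; <⇒≤; <⇒≱; ≮⇒≥; ≰⇒>; 1+n≰n; n<1+n; m<1+n⇒m<n∨m≡n; m≤m⊔n; m≤n⊔m; m≤n⇒m⊓n≡m; m+n≤o⇒m≤o; m+n≤o⇒m≤o∸n)
open import Data.Fin using (Fin) renaming (_≟_ to _≟ᶠ_)
open import Data.Bool using (T)
open import Data.Maybe using (just; nothing; is-just)
open import Data.Unit using (tt)
open import Data.Product using (Σ-syntax; ∃; ∃₂; _×_; _,_; proj₁; proj₂)
open import Data.Product.Properties using (×-≡,≡←≡)
open import Data.Sum using (_⊎_; inj₁; inj₂)
open import Data.List
  using ( List; []; _∷_; [_]; _++_; map; length; take; drop; replicate; allFin; concatMap
        ; cartesianProduct; cartesianProductWith)
open import Data.List.Properties
  using (∷-injective; length-++; length-map; length-tabulate; length-take; length-drop; take++drop≡id; ++-assoc)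
open import Data.List.Membership.Propositional using (_∈_; _∉_; find; lose)
open import Data.List.Membership.Propositional.Properties
  using ( ∈-++⁺ˡ; ∈-++⁺ʳ; ∈-++⁻; ∈-∃++; ∈-allFin; ∈-concatMap⁺
        ; ∈-cartesianProduct⁺; ∈-cartesianProductWith⁺)
open import Data.List.Relation.Unary.Any using (here; there)
open import Data.List.Relation.Unary.All using (All; []; _∷_; lookup)
import Data.List.Relation.Unary.All as All
open import Data.List.Relation.Unary.All.Properties using (++⁻ˡ; ¬Any⇒All¬; ¬All⇒Any¬)
open import Data.List.Relation.Unary.AllPairs using ([]; _∷_)
open import Data.List.Relation.Unary.Unique.Propositional using (Unique)
open import Data.List.Relation.Binary.Permutation.Propositional using (_↭_; ↭-sym)
open import Data.List.Relation.Binary.Permutation.Propositional.Properties using (∈-resp-↭)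
open import Data.List.Relation.Binary.Pointwise using (Pointwise; []; _∷_; Pointwise-≡⇒≡)
import Data.List.Relation.Binary.Pointwise as Pointwise
open import Data.Nat.Induction using (<-rec)
open import Function using (_∘_)
open import Relation.Binary.Definitions using (Monotonic₁)
open import Relation.Binary.PropositionalEquality
  using (_≡_; _≢_; refl; sym; trans; cong; cong₂; subst; module ≡-Reasoning)
open import Relation.Binary.Structures using (IsPartialOrder)
open import Relation.Nullary using (¬_; yes; no; contradiction)
open import Relation.Nullary.Decidable using (decidable-stable)

Unique[xs++x∷ys]⇒Unique[x∷xs] : {A : Set} (xs : List A) {x : A} {ys : List A} →
                                Unique (xs ++ x ∷ ys) → Unique (x ∷ xs)
Unique[xs++x∷ys]⇒Unique[x∷xs] []       _              = [] ∷ []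
Unique[xs++x∷ys]⇒Unique[x∷xs] (y ∷ xs) (y∉ ∷ unique)
  with x∉xs ∷ uniqueXs ← Unique[xs++x∷ys]⇒Unique[x∷xs] xs unique =
  ((λ x≡y → lookup y∉ (∈-++⁺ʳ xs (here refl)) (sym x≡y)) ∷ x∉xs) ∷ (++⁻ˡ xs y∉ ∷ uniqueXs)

∈-++-∷⁻ : {A : Set} (xs : List A) {x y : A} {ys : List A} → y ∈ xs ++ x ∷ ys → x ≢ y → y ∈ xs ++ ys
∈-++-∷⁻ xs y∈ x≢y with ∈-++⁻ xs y∈
... | inj₁ y∈xs         = ∈-++⁺ˡ y∈xs
... | inj₂ (here y≡x)   = contradiction (sym y≡x) x≢y
... | inj₂ (there y∈ys) = ∈-++⁺ʳ xs y∈ys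

length-++-∷ : {A : Set} (xs : List A) {x : A} {ys : List A} → length (xs ++ x ∷ ys) ≡ suc (length (xs ++ ys))
length-++-∷ xs {x} {ys} = begin
  length (xs ++ x ∷ ys)       ≡⟨ length-++ xs ⟩
  length xs + suc (length ys) ≡⟨ +-suc (length xs) (length ys) ⟩
  suc (length xs + length ys) ≡⟨ cong suc (length-++ xs) ⟨
  suc (length (xs ++ ys))     ∎
  where open ≡-Reasoning

Unique⇒length≤ : {A : Set} {xs ys : List A} → Unique xs → All (_∈ ys) xs → length xs ≤ length ys
Unique⇒length≤ [] [] = z≤n
Unique⇒length≤ (x∉xs ∷ unique) (x∈ys ∷ xs⊆ys) with zs₁ , zs₂ , refl ← ∈-∃++ x∈ys =
  subst (_ ≤_) (sym (length-++-∷ zs₁))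
    (s≤s (Unique⇒length≤ unique
      (All.zipWith (λ (y∈ , x≢y) → ∈-++-∷⁻ zs₁ y∈ x≢y) (xs⊆ys , x∉xs))))

Unique⇒length≤size : ∀ {n} {xs : List (Fin n)} → Unique xs → length xs ≤ n
Unique⇒length≤size {xs = xs} unique =
  subst (length xs ≤_) (length-tabulate _) (Unique⇒length≤ unique (All.tabulate (λ {x} _ → ∈-allFin x)))

listsOfLength≤ : {A : Set} → ℕ → List A → List (List A)
listsOfLength≤ zero    xs = [ [] ]
listsOfLength≤ (suc k) xs = [] ∷ cartesianProductWith _∷_ xs (listsOfLength≤ k xs)

∈-listsOfLength≤ : {A : Set} (k : ℕ) {xs ys : List A} → All (_∈ xs) ys → length ys ≤ k →
                   ys ∈ listsOfLength≤ k xs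
∈-listsOfLength≤ zero    []         _         = here refl
∈-listsOfLength≤ (suc k) []         _         = here refl
∈-listsOfLength≤ (suc k) (y∈ ∷ ys⊆) (s≤s ≤k) =
  there (∈-cartesianProductWith⁺ _∷_ y∈ (∈-listsOfLength≤ k ys⊆ ≤k))

map-proj-injective : {A B : Set} {xs ys : List (A × B)} →
                     map proj₁ xs ≡ map proj₁ ys → map proj₂ xs ≡ map proj₂ ys → xs ≡ ys
map-proj-injective {xs = []}    {[]}    _  _ = refl
map-proj-injective {xs = []}    {_ ∷ _} () _
map-proj-injective {xs = _ ∷ _} {[]}    () _
map-proj-injective {xs = (_ , _) ∷ _} {(_ , _) ∷ _} eq₁ eq₂
  with refl , eq₁′ ← ∷-injective eq₁ | refl , eq₂′ ← ∷-injective eq₂ =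
  cong (_ ∷_) (map-proj-injective eq₁′ eq₂′)

step-increasing⇒monotonic : {g : ℕ → ℕ} → (∀ i → g i < g (suc i)) → Monotonic₁ _<_ _<_ g
step-increasing⇒monotonic step {i} {suc j} i<1+j with m<1+n⇒m<n∨m≡n i<1+j
... | inj₁ i<j  = <-trans (step-increasing⇒monotonic step i<j) (step j)
... | inj₂ refl = step i

Unbounded : (ℕ → Set) → Set
Unbounded P = ∀ b → ∃ λ j → b ≤ j × P j

unbounded⇒subsequence : {P : ℕ → Set} → Unbounded P →
                        Σ[ g ∈ (ℕ → ℕ) ] (Monotonic₁ _<_ _<_ g × (∀ i → P (g i)))
unbounded⇒subsequence {P} unbounded = g , step-increasing⇒monotonic g-step , P-g
  where
  g : ℕ → ℕ
  g zero    = proj₁ (unbounded 0)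
  g (suc i) = proj₁ (unbounded (suc (g i)))
  g-step : ∀ i → g i < g (suc i)
  g-step i = proj₁ (proj₂ (unbounded (suc (g i))))
  P-g : ∀ i → P (g i)
  P-g zero    = proj₂ (proj₂ (unbounded 0))
  P-g (suc i) = proj₂ (proj₂ (unbounded (suc (g i))))

AscendingSubsequence : {A : Set} → (A → A → Set) → (ℕ → A) → Set
AscendingSubsequence _≼_ f =
  Σ[ g ∈ (ℕ → ℕ) ] (Monotonic₁ _<_ _<_ g × (∀ {i j} → i < j → f (g i) ≼ f (g j)))

module Classical (em : ExcludedMiddle 0ℓ) where

  ¬∀⇒∃¬ : {P : ℕ → Set} → ¬ (∀ i → P i) → ∃ λ i → ¬ P i
  ¬∀⇒∃¬ {P} ¬∀ with em {∃ λ i → ¬ P i}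
  ... | yes ∃¬ = ∃¬
  ... | no  ∄¬ = contradiction (λ i → decidable-stable em (λ ¬Pi → ∄¬ (i , ¬Pi))) ¬∀

  infinitePigeonhole : {A : Set} (f : ℕ → A) (xs : List A) (b : ℕ) → (∀ i → b ≤ i → f i ∈ xs) →
                       ∃ λ a → Unbounded (λ i → f i ≡ a)
  infinitePigeonhole f []       b f∈ with f∈ b ≤-refl
  ... | ()
  infinitePigeonhole f (x ∷ xs) b f∈ with em {Unbounded (λ i → f i ≡ x)}
  ... | yes unbounded = x , unbounded
  ... | no  bounded with b′ , ¬late ← ¬∀⇒∃¬ bounded = infinitePigeonhole f xs (b ⊔ b′) f∈xs
    where
    f∈xs : ∀ i → b ⊔ b′ ≤ i → f i ∈ xs
    f∈xs i b⊔b′≤i with f∈ i (≤-trans (m≤m⊔n b b′) b⊔b′≤i)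
    ... | here fi≡x   = contradiction (i , ≤-trans (m≤n⊔m b b′) b⊔b′≤i , fi≡x) ¬late
    ... | there fi∈xs = fi∈xs

  constantSubsequence : {A : Set} (f : ℕ → A) (xs : List A) → (∀ i → f i ∈ xs) →
                        ∃ λ a → Σ[ g ∈ (ℕ → ℕ) ] (Monotonic₁ _<_ _<_ g × (∀ i → f (g i) ≡ a))
  constantSubsequence f xs f∈xs with a , unbounded ← infinitePigeonhole f xs 0 (λ i _ → f∈xs i) =
    a , unbounded⇒subsequence unbounded

  leastWitness : (P : ℕ → Set) → ∀ v → P v → ∃ λ m → P m × (∀ w → P w → m ≤ w)
  leastWitness P = <-rec (λ v → P v → Least) least
    where
    Least : Set
    Least = ∃ λ m → P m × (∀ w → P w → m ≤ w)
    least : ∀ v → (∀ {u} → u < v → P u → Least) → P v → Least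
    least v smaller Pv with em {∃ λ u → u < v × P u}
    ... | yes (u , u<v , Pu) = smaller u<v Pu
    ... | no  none           = v , Pv , λ w Pw → ≮⇒≥ (λ w<v → none (w , w<v , Pw))

  suffixMinima-unbounded : (h : ℕ → ℕ) → Unbounded (λ j → ∀ k → j ≤ k → h j ≤ h k)
  suffixMinima-unbounded h b
    with _ , (j , b≤j , refl) , least ←
           leastWitness (λ v → ∃ λ j → b ≤ j × h j ≡ v) (h b) (b , ≤-refl , refl) =
    j , b≤j , λ k j≤k → least (h k) (k , ≤-trans b≤j j≤k , refl)

  nondecreasingSubsequence : (h : ℕ → ℕ) → AscendingSubsequence _≤_ h
  nondecreasingSubsequence h with g , g-mono , minimal ← unbounded⇒subsequence (suffixMinima-unbounded h) =
    g , g-mono , λ i<j → minimal _ _ (<⇒≤ (g-mono i<j))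

  dickson : ∀ l (f : ℕ → List ℕ) → (∀ i → length (f i) ≡ l) → AscendingSubsequence (Pointwise _≤_) f
  dickson zero f empty = (λ i → i) , (λ i<j → i<j) , λ {i} {j} _ → nil (empty i) (empty j)
    where
    nil : {xs ys : List ℕ} → length xs ≡ 0 → length ys ≡ 0 → Pointwise _≤_ xs ys
    nil {[]} {[]} _ _ = []
  dickson (suc l) f len =
    let g , g-mono , hd≤ = nondecreasingSubsequence (hd ∘ f)
        h , h-mono , tl≤ = dickson l (tl ∘ f ∘ g) (λ i → length-tl {f (g i)} (len (g i)))
    in  g ∘ h , (λ i<j → g-mono (h-mono i<j)) ,
        λ {i} {j} i<j → cons {f (g (h i))} {f (g (h j))} (len (g (h i))) (len (g (h j)))
                             (hd≤ (h-mono i<j)) (tl≤ i<j)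
    where
    hd : List ℕ → ℕ
    hd []      = 0
    hd (x ∷ _) = x
    tl : List ℕ → List ℕ
    tl []       = []
    tl (_ ∷ xs) = xs
    length-tl : {xs : List ℕ} → length xs ≡ suc l → length (tl xs) ≡ l
    length-tl {_ ∷ _} eq = suc-injective eq
    cons : {xs ys : List ℕ} → length xs ≡ suc l → length ys ≡ suc l →
           hd xs ≤ hd ys → Pointwise _≤_ (tl xs) (tl ys) → Pointwise _≤_ xs ys
    cons {_ ∷ _} {_ ∷ _} _ _ x≤y xs≤ys = x≤y ∷ xs≤ys

module PathCombinatorics {n : ℕ} (M : Matrices n) where
  open StaticGraph M
  open import Data.List.Membership.DecPropositional (_≟ᶠ_ {n}) using (_∈?_)

  endNode-++ : ∀ v X Y → endNode v (X ++ Y) ≡ endNode (endNode v X) Y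
  endNode-++ v []      Y = refl
  endNode-++ v (e ∷ X) Y = endNode-++ (tgt e) X Y

  Chain-++⁻ : ∀ v X {Y} → Chain v (X ++ Y) → Chain v X × Chain (endNode v X) Y
  Chain-++⁻ v []      chain             = tt , chain
  Chain-++⁻ v (e ∷ X) (src≡v , chain) = let X-chain , Y-chain = Chain-++⁻ (tgt e) X chain
                                         in (src≡v , X-chain) , Y-chain

  Chain-++⁺ : ∀ v X {Y} → Chain v X → Chain (endNode v X) Y → Chain v (X ++ Y)
  Chain-++⁺ v []      _                 Y-chain = Y-chain
  Chain-++⁺ v (e ∷ X) (src≡v , X-chain) Y-chain = src≡v , Chain-++⁺ (tgt e) X X-chain Y-chain

  Step⇒IsPath : ∀ {p q p₁} → Step p q p₁ → IsPath p → IsPath p₁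
  Step⇒IsPath (remove v es₁ w qs es₂ refl (_ , _ , closed , _) _) path =
    let before , rest = Chain-++⁻ v es₁ path
        _ , after     = Chain-++⁻ w qs rest
    in  Chain-++⁺ v es₁ before (subst (λ u → Chain u es₂) closed after)

  Steps⇒elementaryCircuits : ∀ {p R p′} → Steps p R p′ → IsPath p → IsPath p′ × All IsElementaryCircuit R
  Steps⇒elementaryCircuits (done _) path = path , []
  Steps⇒elementaryCircuits (step s@(remove _ _ _ _ _ _ circuit _) steps) path =
    let path′ , circuits = Steps⇒elementaryCircuits steps (Step⇒IsPath s path)
    in  path′ , circuit ∷ circuits

  ∈-dropLast⁻ : {A : Set} {x : A} (xs : List A) → x ∈ dropLast xs → x ∈ xs
  ∈-dropLast⁻ (_ ∷ _ ∷ _)  (here x≡)  = here x≡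
  ∈-dropLast⁻ (_ ∷ y ∷ xs) (there x∈) = there (∈-dropLast⁻ (y ∷ xs) x∈)

  length-dropLast-∷ : {A : Set} (x : A) (xs : List A) → length (dropLast (x ∷ xs)) ≡ length xs
  length-dropLast-∷ x []       = refl
  length-dropLast-∷ x (y ∷ xs) = cong suc (length-dropLast-∷ y xs)

  nodes-++ : ∀ u X Y → nodes (u , X ++ Y) ≡ dropLast (nodes (u , X)) ++ nodes (endNode u X , Y)
  nodes-++ u []      Y = refl
  nodes-++ u (e ∷ X) Y = cong (u ∷_) (nodes-++ (tgt e) X Y)

  ∈-nodes-++ˡ : ∀ {x} v X Y → x ∈ nodes (v , X) → x ∈ nodes (v , X ++ Y)
  ∈-nodes-++ˡ v X       Y (here x≡v)  = here x≡v
  ∈-nodes-++ˡ v (e ∷ X) Y (there x∈) = there (∈-nodes-++ˡ (tgt e) X Y x∈)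

  ∈-nodes-++ʳ : ∀ {x} v X Y → x ∈ nodes (endNode v X , Y) → x ∈ nodes (v , X ++ Y)
  ∈-nodes-++ʳ v []      Y x∈ = x∈
  ∈-nodes-++ʳ v (e ∷ X) Y x∈ = there (∈-nodes-++ʳ (tgt e) X Y x∈)

  ∈-nodes⁻ : ∀ {x} u B → x ∈ nodes (u , B) → ∃₂ λ X Y → B ≡ X ++ Y × endNode u X ≡ x
  ∈-nodes⁻ u B       (here refl) = [] , B , refl , refl
  ∈-nodes⁻ u (e ∷ B) (there x∈) =
    let X , Y , B≡ , end≡ = ∈-nodes⁻ (tgt e) B x∈ in e ∷ X , Y , cong (e ∷_) B≡ , end≡

  record ElementarySubcircuit (w : Fin n) (B : List Arc) : Set where
    field
      before circuit after : List Arc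
      splitting            : B ≡ before ++ circuit ++ after
      elementary           : IsElementaryCircuit (endNode w before , circuit)

  -- The shortest suffix of a path whose nodes are not distinct starts with an elementary circuit.
  uniqueNodes⊎subcircuit : ∀ w B → Chain w B → Unique (nodes (w , B)) ⊎ ElementarySubcircuit w B
  uniqueNodes⊎subcircuit w []      _                = inj₁ ([] ∷ [])
  uniqueNodes⊎subcircuit w (e ∷ B) (src≡w , chain) with uniqueNodes⊎subcircuit (tgt e) B chain
  ... | inj₂ c = inj₂ (record
    { before = e ∷ before ; circuit = circuit ; after = after
    ; splitting = cong (e ∷_) splitting ; elementary = elementary })
    where open ElementarySubcircuit c
  ... | inj₁ unique with w ∈? nodes (tgt e , B)
  ...   | no  w∉ = inj₁ (¬Any⇒All¬ _ w∉ ∷ unique)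
  ...   | yes w∈ with X , Y , refl , end≡w ← ∈-nodes⁻ (tgt e) B w∈ = inj₂ (record
    { before = [] ; circuit = e ∷ X ; after = Y ; splitting = refl
    ; elementary = (src≡w , proj₁ (Chain-++⁻ (tgt e) X chain)) , (λ ()) , end≡w
                 , Unique[xs++x∷ys]⇒Unique[x∷xs] (dropLast (nodes (tgt e , X)))
                     (subst (λ u → Unique (dropLast (nodes (tgt e , X)) ++ u ∷ map tgt Y)) end≡w
                       (subst Unique (nodes-++ (tgt e) X Y) unique)) })

  long⇒subcircuit : ∀ w B → Chain w B → n ≤ length B → ElementarySubcircuit w B
  long⇒subcircuit w B chain n≤|B| with uniqueNodes⊎subcircuit w B chain
  ... | inj₂ c      = c
  ... | inj₁ unique =
    contradiction n≤|B| (<⇒≱ (subst (_≤ n) (cong suc (length-map tgt B)) (Unique⇒length≤size unique)))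

  outsideNodes : Fin n → List Arc → List Arc → List Arc → List (Fin n)
  outsideNodes v A B C = nodes (v , A) ++ nodes (endNode v (A ++ B) , C)

  stepAtSubcircuit : ∀ v A B₁ Q B₂ C → IsElementaryCircuit (endNode (endNode v A) B₁ , Q) →
    All (_∈ outsideNodes v A (B₁ ++ Q ++ B₂) C) (nodes (endNode v A , B₁ ++ Q ++ B₂)) →
    Step (v , A ++ (B₁ ++ Q ++ B₂) ++ C) (endNode (endNode v A) B₁ , Q) (v , (A ++ B₁) ++ B₂ ++ C)
  stepAtSubcircuit v A B₁ Q B₂ C elementary@(_ , _ , closed , _) covered =
    subst (λ es → Step (v , es) (w , Q) (v , (A ++ B₁) ++ B₂ ++ C)) (sym reassociate)
      (remove v (A ++ B₁) w Q (B₂ ++ C) (sym (endNode-++ v A B₁)) elementary (All.tabulate inner∈outside))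
    where
    open ≡-Reasoning
    w : Fin n
    w = endNode (endNode v A) B₁
    reassociate : A ++ (B₁ ++ Q ++ B₂) ++ C ≡ (A ++ B₁) ++ Q ++ B₂ ++ C
    reassociate = begin
      A ++ (B₁ ++ Q ++ B₂) ++ C ≡⟨ cong (A ++_) (++-assoc B₁ (Q ++ B₂) C) ⟩
      A ++ B₁ ++ (Q ++ B₂) ++ C ≡⟨ cong (λ X → A ++ B₁ ++ X) (++-assoc Q B₂ C) ⟩
      A ++ B₁ ++ Q ++ B₂ ++ C   ≡⟨ ++-assoc A B₁ _ ⟨
      (A ++ B₁) ++ Q ++ B₂ ++ C ∎
    blockEnd : endNode v (A ++ B₁ ++ Q ++ B₂) ≡ endNode w B₂
    blockEnd = begin
      endNode v (A ++ B₁ ++ Q ++ B₂)        ≡⟨ endNode-++ v A _ ⟩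
      endNode (endNode v A) (B₁ ++ Q ++ B₂) ≡⟨ endNode-++ _ B₁ _ ⟩
      endNode w (Q ++ B₂)                   ≡⟨ endNode-++ w Q B₂ ⟩
      endNode (endNode w Q) B₂              ≡⟨ cong (λ u → endNode u B₂) closed ⟩
      endNode w B₂                          ∎
    inner∈outside : ∀ {x} → x ∈ innerNodes (w , Q) → x ∈ nodes (v , A ++ B₁) ++ nodes (w , B₂ ++ C)
    inner∈outside {x} x∈Q
      with ∈-++⁻ (nodes (v , A))
             (lookup covered (∈-nodes-++ʳ (endNode v A) B₁ (Q ++ B₂)
                                (∈-nodes-++ˡ w Q B₂ (there (∈-dropLast⁻ _ x∈Q)))))
    ... | inj₁ x∈A = ∈-++⁺ˡ (∈-nodes-++ˡ v A B₁ x∈A)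
    ... | inj₂ x∈C = ∈-++⁺ʳ (nodes (v , A ++ B₁))
                             (∈-nodes-++ʳ w B₂ C (subst (λ u → x ∈ nodes (u , C)) blockEnd x∈C))

  stepInsideBlock : ∀ v A B C → Chain v (A ++ B ++ C) → n ≤ length B →
                    All (_∈ outsideNodes v A B C) (nodes (endNode v A , B)) →
                    ∃₂ λ q p₁ → Step (v , A ++ B ++ C) q p₁
  stepInsideBlock v A B C chain n≤|B| covered
    with long⇒subcircuit (endNode v A) B
           (proj₁ (Chain-++⁻ (endNode v A) B (proj₂ (Chain-++⁻ v A chain)))) n≤|B|
  ... | record { before = B₁ ; circuit = Q ; after = B₂ ; splitting = refl ; elementary = elementary } =
    _ , _ , stepAtSubcircuit v A B₁ Q B₂ C elementary covered

  shifts : List Shift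
  shifts = minus1 ∷ zero ∷ plus1 ∷ []

  ∈-shifts : ∀ s → s ∈ shifts
  ∈-shifts minus1 = here refl
  ∈-shifts zero   = there (here refl)
  ∈-shifts plus1  = there (there (here refl))

  arcIfPresent : (m : ℚ-∞) → (T (is-just m) → Arc) → List Arc
  arcIfPresent (just _) mk = [ mk tt ]
  arcIfPresent nothing  _  = []

  ∈-arcIfPresent : ∀ m (mk : T (is-just m) → Arc) (present : T (is-just m)) → mk present ∈ arcIfPresent m mk
  ∈-arcIfPresent (just _) mk _ = here refl

  arcsBetween : Fin n → Fin n → List Arc
  arcsBetween i j = concatMap (λ s → arcIfPresent (M s j i) (arc i j s)) shifts

  arcsFrom : Fin n → List Arc
  arcsFrom i = concatMap (arcsBetween i) (allFin n)

  arcs : List Arc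
  arcs = concatMap arcsFrom (allFin n)

  ∈-arcs : ∀ e → e ∈ arcs
  ∈-arcs (arc i j s present) =
    ∈-concatMap⁺ arcsFrom (lose (∈-allFin i) (∈-concatMap⁺ (arcsBetween i) (lose (∈-allFin j)
      (∈-concatMap⁺ (λ s → arcIfPresent (M s j i) (arc i j s)) (lose (∈-shifts s)
        (∈-arcIfPresent (M s j i) (arc i j s) present))))))

  pathsOfLength≤ : ℕ → List RawPath
  pathsOfLength≤ k = cartesianProduct (allFin n) (listsOfLength≤ k arcs)

  ∈-pathsOfLength≤ : ∀ k v es → length es ≤ k → (v , es) ∈ pathsOfLength≤ k
  ∈-pathsOfLength≤ k v es ≤k =
    ∈-cartesianProduct⁺ (∈-allFin v) (∈-listsOfLength≤ k (All.tabulate (λ {e} _ → ∈-arcs e)) ≤k)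

  elementaryCircuit∈paths : ∀ {q} → IsElementaryCircuit q → q ∈ pathsOfLength≤ n
  elementaryCircuit∈paths {w , qs} (_ , _ , _ , distinct) =
    ∈-pathsOfLength≤ n w qs
      (subst (_≤ n) (trans (length-dropLast-∷ w (map tgt qs)) (length-map tgt qs)) (Unique⇒length≤size distinct))

  ∈-expand : ∀ {q} L → All (λ qx → 1 ≤ proj₂ qx) L → q ∈ map proj₁ L → q ∈ expand L
  ∈-expand ((_ , suc _) ∷ _) (_ ∷ _)        (here q≡)  = here q≡
  ∈-expand ((q , x) ∷ L)     (_ ∷ positive) (there q∈) = ∈-++⁺ʳ (replicate x q) (∈-expand L positive q∈)

  decompositionCircuits∈paths : ∀ {R L} → All IsElementaryCircuit R → All (λ qx → 1 ≤ proj₂ qx) L →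
                                R ↭ expand L → All (_∈ pathsOfLength≤ n) (map proj₁ L)
  decompositionCircuits∈paths {L = L} circuits positive R↭L = All.tabulate λ q∈ →
    elementaryCircuit∈paths (lookup circuits (∈-resp-↭ (↭-sym R↭L) (∈-expand L positive q∈)))

  ≼CPD-isPartialOrder : IsPartialOrder _≈CPD_ _≼CPD_
  ≼CPD-isPartialOrder = record
    { isPreorder = record
      { isEquivalence = record { refl = refl ; sym = sym ; trans = trans }
      ; reflexive     = λ { {(_ , _) , _} {(_ , _) , _} refl → refl , refl , Pointwise.refl ≤-refl }
      ; trans         = λ (p≡ , qs≡ , xs≤) (p≡′ , qs≡′ , xs≤′) →
                          trans p≡ p≡′ , trans qs≡ qs≡′ , Pointwise.transitive ≤-trans xs≤ xs≤′
      }
    ; antisym = λ { {(_ , _) , _} {(_ , _) , _} (p≡ , qs≡ , xs≤) (_ , _ , ys≤) →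
                    cong₂ _,_ p≡ (map-proj-injective qs≡
                      (Pointwise-≡⇒≡ (Pointwise.antisymmetric ≤-antisym xs≤ ys≤))) }
    }

module CPDOrder (em : ExcludedMiddle 0ℓ) {n : ℕ} (M : Matrices n) where
  open StaticGraph M
  open PathCombinatorics M
  open Classical em

  module _ {v : Fin n} {es : List Arc} (chain : Chain v es) (irreducible : Irreducible (v , es)) where

    privateNode : ∀ A B C → es ≡ A ++ B ++ C → n ≤ length B →
                  ∃ λ x → x ∈ nodes (endNode v A , B) × x ∉ outsideNodes v A B C
    privateNode A B C es≡ n≤|B| with em {All (_∈ outsideNodes v A B C) (nodes (endNode v A , B))}
    ... | yes covered =
      let q , p₁ , s = stepInsideBlock v A B C (subst (Chain v) es≡ chain) n≤|B| covered
      in  contradiction (subst (λ es → Step (v , es) q p₁) (sym es≡) s) (irreducible q p₁)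
    ... | no uncovered = find (¬All⇒Any¬ (λ _ → em) _ uncovered)

    privateNodes : ∀ t A R → es ≡ A ++ R → t * n ≤ length R →
                   Σ[ D ∈ List (Fin n) ] (Unique D × length D ≡ t × All (_∉ nodes (v , A)) D)
    privateNodes zero    A R _   _     = [] , [] , refl , []
    privateNodes (suc t) A R es≡ ≤|R| =
      let x , x∈B , x∉outside      = privateNode A (take n R) (drop n R) es≡′ n≤|B|
          D , unique , |D|≡t , D∉AB = privateNodes t (A ++ take n R) (drop n R)
                                                   (trans es≡′ (sym (++-assoc A _ _))) ≤|C|
      in  x ∷ D ,
          All.map (λ y∉AB x≡y → y∉AB (subst (_∈ _) x≡y (∈-nodes-++ʳ v A _ x∈B))) D∉AB ∷ unique ,
          cong suc |D|≡t ,
          x∉outside ∘ ∈-++⁺ˡ ∷ All.map (λ y∉AB → y∉AB ∘ ∈-nodes-++ˡ v A _) D∉AB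
      where
      es≡′ : es ≡ A ++ take n R ++ drop n R
      es≡′ = trans es≡ (cong (A ++_) (sym (take++drop≡id n R)))
      n≤|B| : n ≤ length (take n R)
      n≤|B| = ≤-reflexive (sym (trans (length-take n R) (m≤n⇒m⊓n≡m (m+n≤o⇒m≤o n ≤|R|))))
      ≤|C| : t * n ≤ length (drop n R)
      ≤|C| = subst (t * n ≤_) (sym (length-drop n R))
               (m+n≤o⇒m≤o∸n (t * n) (subst (_≤ length R) (+-comm n (t * n)) ≤|R|))

  irreducible⇒length< : ∀ {v es} → Chain v es → Irreducible (v , es) → length es < suc n * n
  irreducible⇒length< {es = es} chain irreducible with suc n * n ≤? length es
  ... | no  short = ≰⇒> short
  ... | yes long with D , unique , |D|≡1+n , _ ← privateNodes chain irreducible (suc n) [] es refl long =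
    contradiction (subst (_≤ n) |D|≡1+n (Unique⇒length≤size unique)) 1+n≰n

  Skeleton : Set
  Skeleton = RawPath × List RawPath

  skeleton : CPD → Skeleton
  skeleton ((p′ , L) , _) = p′ , map proj₁ L

  multiplicities : CPD → List ℕ
  multiplicities ((_ , L) , _) = map proj₂ L

  skeletons : List Skeleton
  skeletons = cartesianProduct (pathsOfLength≤ (suc n * n))
                               (listsOfLength≤ (length (pathsOfLength≤ n)) (pathsOfLength≤ n))

  skeleton∈skeletons : ∀ c → skeleton c ∈ skeletons
  skeleton∈skeletons (((v′ , es′) , L) , _ , path , _ , steps , irreducible , distinct , positive , R↭L) =
    let path′ , circuits = Steps⇒elementaryCircuits steps path
        L⊆paths          = decompositionCircuits∈paths circuits positive R↭L
    in  ∈-cartesianProduct⁺ (∈-pathsOfLength≤ _ v′ es′ (<⇒≤ (irreducible⇒length< path′ irreducible)))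
                            (∈-listsOfLength≤ _ L⊆paths (Unique⇒length≤ distinct L⊆paths))

  length-multiplicities : ∀ {c s} → skeleton c ≡ s → length (multiplicities c) ≡ length (proj₂ s)
  length-multiplicities {(_ , L) , _} refl = trans (length-map proj₂ L) (sym (length-map proj₁ L))

  ≼CPD-ascendingSubsequence : (f : ℕ → CPD) → AscendingSubsequence _≼CPD_ f
  ≼CPD-ascendingSubsequence f =
    let s , g , g-mono , skeleton≡s = constantSubsequence (skeleton ∘ f) skeletons (skeleton∈skeletons ∘ f)
        h , h-mono , multiplicities≤ = dickson (length (proj₂ s)) (multiplicities ∘ f ∘ g)
                                              (λ i → length-multiplicities {f (g i)} (skeleton≡s i))
    in  g ∘ h , (λ i<j → g-mono (h-mono i<j)) , λ {i} {j} i<j →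
        let p≡ , qs≡ = ×-≡,≡←≡ (trans (skeleton≡s (h i)) (sym (skeleton≡s (h j))))
        in  p≡ , qs≡ , multiplicities≤ i<j

mainTheorem4 : ((P : Set) → Dec P) →
    (n : ℕ) (M : Matrices n) →
    IsWellPartialOrder (StaticGraph._≈CPD_ M) (StaticGraph._≼CPD_ M)
mainTheorem4 lem n M = record
  { isPartialOrder       = ≼CPD-isPartialOrder
  ; ascendingSubsequence = λ f →
      let g , g-mono , ascends = ≼CPD-ascendingSubsequence f
      in  g , (λ i → g-mono (n<1+n i)) , (λ i → ascends (n<1+n i))
  }
  where
  open PathCombinatorics M
  open CPDOrder (λ {P} → lem P) M
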